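{- There is no connected finite simple graph $G$ (with at least one vertex) such that $G\cong A_1(G)$.
   Context: A $1$-arc of $G$ is an ordered pair $(u,v)$ with $uv\in E(G)$, written $uv$; it can be shunted onto the $1$-arc $vw$ if $w\neq u$ and $vw\in E(G)$. The $1$-shunt intersection graph $A_1(G)$ has as vertices the $1$-arcs that can be shunted onto some other $1$-arc; two distinct vertices are adjacent iff the corresponding $1$-arcs share a vertex of $G$. -}

module Defs where

open import Data.Nat using (ℕ)
open import Data.Bool using (Bool; true; false; T; _∧_; not)
open import Data.Fin using (Fin)
open import Data.Fin.Properties using (any?) renaming (_≟_ to _≟ᶠ_)
open import Data.Product using (Σ; _×_; _,_; proj₁; ∃)
open import Data.Sum using (_⊎_)
open import Relation.Nullary using (¬_; ⌊_⌋)
open import Relation.Nullary.Decidable using (_×-dec_; ¬?)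
open import Relation.Binary.PropositionalEquality using (_≡_; _≢_)
open import Function.Definitions using (Bijective)
open import Function.Bundles using (_⇔_)

record Graph (n : ℕ) : Set where
  field
    adj    : Fin n → Fin n → Bool
    adj-sym    : ∀ u v → adj u v ≡ adj v u
    adj-irrefl : ∀ u → adj u u ≡ false

open Graph public

Edge : ∀ {n} → Graph n → Fin n → Fin n → Set
Edge G u v = T (adj G u v)

data Reach {n} (G : Graph n) : Fin n → Fin n → Set where
  here : ∀ {u} → Reach G u u
  step : ∀ {u v w} → Edge G u v → Reach G v w → Reach G u w

Connected : ∀ {n} → Graph n → Set
Connected G = ∀ u v → Reach G u v

-- The 1-arc uv can be shunted onto some 1-arc vw (w ≠ u, vw ∈ E).
-- Decided as a Bool so that the vertex type of A₁(G) below has no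
-- proof-relevant duplication.
shuntable : ∀ {n} → Graph n → Fin n → Fin n → Bool
shuntable {n} G u v =
  adj G u v ∧ ⌊ any? (λ w → T? (adj G v w) ×-dec ¬? (w ≟ᶠ u)) ⌋
  where
    open import Data.Bool.Properties using (T?)

A1Vertex : ∀ {n} → Graph n → Set
A1Vertex {n} G = Σ (Fin n × Fin n) (λ { (u , v) → T (shuntable G u v) })

ShareVertex : ∀ {n} → (Fin n × Fin n) → (Fin n × Fin n) → Set
ShareVertex (u , v) (u' , v') = (u ≡ u' ⊎ u ≡ v') ⊎ (v ≡ u' ⊎ v ≡ v')

A1Adj : ∀ {n} (G : Graph n) → A1Vertex G → A1Vertex G → Set
A1Adj G a b = (proj₁ a ≢ proj₁ b) × ShareVertex (proj₁ a) (proj₁ b)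

IsoToA1 : ∀ {n} → Graph n → Set
IsoToA1 {n} G =
  Σ (Fin n → A1Vertex G) λ f →
    Bijective _≡_ _≡_ f × (∀ x y → Edge G x y ⇔ A1Adj G (f x) (f y))

-- Take a vertex v of maximum degree Δ of G.  If some arc vu can be shunted,
-- then u has a neighbour other than v, so Δ ≥ 2 and v has a neighbour other
-- than u; hence uv can be shunted too.  The arc uv meets at least Δ + 1 other
-- vertices of A₁(G): its reversal vu, an arc x u with x ≠ v, and y v for every
-- neighbour y ≠ u of v.  The vertex of G corresponding to uv would thus have
-- degree Δ + 1.  If no arc out of v can be shunted, connectivity forces G to be
-- a star centred at v, in which every shuntable arc ends at v; two such arcs
-- from distinct leaves a, w meet at v, so a and w would be adjacent in G, and
-- then va could be shunted onto aw.
module Submission where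

open import Data.Bool using (Bool; true; false; T; if_then_else_)
open import Data.Bool.Properties using (T?; T-∧; T-irrelevant)
open import Data.Empty using (⊥; ⊥-elim)
open import Data.Fin using (Fin; zero; suc)
open import Data.Fin.Properties using (any?; suc-injective; injective⇒≤) renaming (_≟_ to _≟ᶠ_)
open import Data.List using (allFin)
open import Data.List.Extrema.Nat using (argmax; f[xs]≤f[argmax])
open import Data.List.Membership.Propositional.Properties using (∈-allFin)
open import Data.List.Relation.Unary.All using (lookup)
open import Data.Nat using (ℕ; zero; suc; _≤_)
open import Data.Nat.Properties using (≤-trans; 1+n≰n)
open import Data.Product using (∃; _×_; _,_; proj₁; proj₂)
open import Data.Sum using (_⊎_; inj₁; inj₂)
open import Data.Unit using (tt)
open import Defs
open import Function using (_∘_)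
open import Function.Bundles using (Equivalence; _⇔_)
open import Function.Definitions using (Injective; Bijective)
open import Relation.Binary.PropositionalEquality
open import Relation.Nullary using (¬_; yes; no)
open import Relation.Nullary.Decidable using (_×-dec_; ¬?; toWitness; fromWitness; decidable-stable)

count : ∀ {n} → (Fin n → Bool) → ℕ
count {zero}  P = zero
count {suc n} P = if P zero then suc (count (P ∘ suc)) else count (P ∘ suc)

index : ∀ {n} (P : Fin n → Bool) (y : Fin n) → T (P y) → Fin (count P)
index {suc n} P zero p with P zero
... | true  = zero
... | false = ⊥-elim p
index {suc n} P (suc y) p with P zero
... | true  = suc (index (P ∘ suc) y p)
... | false = index (P ∘ suc) y p

index-injective : ∀ {n} (P : Fin n → Bool) {a b} (pa : T (P a)) (pb : T (P b)) →
                  index P a pa ≡ index P b pb → a ≡ b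
index-injective {suc n} P {zero}  {zero}  pa pb e = refl
index-injective {suc n} P {zero}  {suc b} pa pb e with P zero
index-injective {suc n} P {zero}  {suc b} pa pb () | true
... | false = ⊥-elim pa
index-injective {suc n} P {suc a} {zero}  pa pb e with P zero
index-injective {suc n} P {suc a} {zero}  pa pb () | true
... | false = ⊥-elim pb
index-injective {suc n} P {suc a} {suc b} pa pb e with P zero
... | true  = cong suc (index-injective (P ∘ suc) pa pb (suc-injective e))
... | false = cong suc (index-injective (P ∘ suc) pa pb e)

member : ∀ {n} (P : Fin n → Bool) → Fin (count P) → Fin n
member {suc n} P i with P zero
member {suc n} P zero    | true  = zero
member {suc n} P (suc i) | true  = suc (member (P ∘ suc) i)
member {suc n} P i       | false = suc (member (P ∘ suc) i)

member-satisfies : ∀ {n} (P : Fin n → Bool) i → T (P (member P i))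
member-satisfies {suc n} P i with P zero in eq
member-satisfies {suc n} P zero    | true  = subst T (sym eq) tt
member-satisfies {suc n} P (suc i) | true  = member-satisfies (P ∘ suc) i
member-satisfies {suc n} P i       | false = member-satisfies (P ∘ suc) i

member-injective : ∀ {n} (P : Fin n → Bool) → Injective _≡_ _≡_ (member P)
member-injective {suc n} P {i} {j} e with P zero
member-injective {suc n} P {zero}  {zero}  e | true  = refl
member-injective {suc n} P {suc i} {suc j} e | true  =
  cong suc (member-injective (P ∘ suc) (suc-injective e))
member-injective {suc n} P {i}     {j}     e | false =
  member-injective (P ∘ suc) (suc-injective e)

injection⇒≤count : ∀ {k n} (P : Fin n → Bool) (h : Fin k → Fin n) →
                   (∀ i → T (P (h i))) → Injective _≡_ _≡_ h → k ≤ count P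
injection⇒≤count P h Ph h-injective =
  injective⇒≤ (λ e → h-injective (index-injective P (Ph _) (Ph _) e))

count≤1 : ∀ {n} (P : Fin n → Bool) (u : Fin n) → (∀ y → T (P y) → y ≡ u) → count P ≤ 1
count≤1 P u only-u = injective⇒≤ {f = λ _ → zero {0}} λ {i} {j} _ →
  member-injective P (trans (only-u _ (member-satisfies P i)) (sym (only-u _ (member-satisfies P j))))

module _ {n : ℕ} (G : Graph n) where

  degree : Fin n → ℕ
  degree x = count (adj G x)

  maxDegreeVertex : Fin n → ∃ λ v → ∀ y → degree y ≤ degree v
  maxDegreeVertex x =
    argmax degree x (allFin n) , λ y → lookup (f[xs]≤f[argmax] x (allFin n)) (∈-allFin y)

  edge-sym : ∀ {u v} → Edge G u v → Edge G v u
  edge-sym {u} {v} = subst T (adj-sym G u v)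

  edge⇒≢ : ∀ {u v} → Edge G u v → u ≢ v
  edge⇒≢ {u} e refl = subst T (adj-irrefl G u) e

  shuntable⇒ : ∀ {u v} → T (shuntable G u v) → Edge G u v × ∃ λ w → Edge G v w × w ≢ u
  shuntable⇒ {u} {v} s with Equivalence.to T-∧ s
  ... | uv , onward = uv , toWitness {a? = any? (λ w → T? (adj G v w) ×-dec ¬? (w ≟ᶠ u))} onward

  shuntable⁺ : ∀ {u v w} → Edge G u v → Edge G v w → w ≢ u → T (shuntable G u v)
  shuntable⁺ {u} {v} {w} uv vw w≢u = Equivalence.from T-∧
    (uv , fromWitness {a? = any? (λ w → T? (adj G v w) ×-dec ¬? (w ≟ᶠ u))} (w , vw , w≢u))

  A1Vertex-≡ : ∀ {a b : A1Vertex G} → proj₁ a ≡ proj₁ b → a ≡ b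
  A1Vertex-≡ {p , s} {.p , t} refl = cong (p ,_) (T-irrelevant s t)

  two-neighbours⇒2≤degree : ∀ {v a b} → Edge G v a → Edge G v b → a ≢ b → 2 ≤ degree v
  two-neighbours⇒2≤degree {v} {a} {b} va vb a≢b =
    injection⇒≤count (adj G v) pick pick-adjacent pick-injective
    where
      pick : Fin 2 → Fin n
      pick zero    = a
      pick (suc _) = b
      pick-adjacent : ∀ i → Edge G v (pick i)
      pick-adjacent zero       = va
      pick-adjacent (suc zero) = vb
      pick-injective : Injective _≡_ _≡_ pick
      pick-injective {zero}     {zero}     _ = refl
      pick-injective {zero}     {suc zero} e = ⊥-elim (a≢b e)
      pick-injective {suc zero} {zero}     e = ⊥-elim (a≢b (sym e))
      pick-injective {suc zero} {suc zero} _ = refl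

  2≤degree⇒other-neighbour : ∀ {v} → 2 ≤ degree v → (u : Fin n) → ∃ λ w → Edge G v w × w ≢ u
  2≤degree⇒other-neighbour {v} 2≤deg u with any? (λ w → T? (adj G v w) ×-dec ¬? (w ≟ᶠ u))
  ... | yes found = found
  ... | no none   = ⊥-elim (1+n≰n (≤-trans 2≤deg (count≤1 (adj G v) u only-u)))
    where
      only-u : ∀ y → Edge G v y → y ≡ u
      only-u y vy = decidable-stable (y ≟ᶠ u) (λ y≢u → none (y , vy , y≢u))

  module ArcsAround {u v : Fin n} (vu-shuntable : T (shuntable G v u)) where

    vu : Edge G v u
    vu = proj₁ (shuntable⇒ vu-shuntable)

    x : Fin n
    x = proj₁ (proj₂ (shuntable⇒ vu-shuntable))

    ux : Edge G u x
    ux = proj₁ (proj₂ (proj₂ (shuntable⇒ vu-shuntable)))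

    x≢v : x ≢ v
    x≢v = proj₂ (proj₂ (proj₂ (shuntable⇒ vu-shuntable)))

    -- the neighbour u itself stands for the reversed arc vu
    spoke : (y : Fin n) → Edge G v y → A1Vertex G
    spoke y vy with y ≟ᶠ u
    ... | yes _   = (v , u) , vu-shuntable
    ... | no y≢u  = (y , v) , shuntable⁺ (edge-sym vy) vu (y≢u ∘ sym)

    spoke-injective : ∀ {y₁ y₂} (vy₁ : Edge G v y₁) (vy₂ : Edge G v y₂) →
                      proj₁ (spoke y₁ vy₁) ≡ proj₁ (spoke y₂ vy₂) → y₁ ≡ y₂
    spoke-injective {y₁} {y₂} vy₁ vy₂ e with y₁ ≟ᶠ u | y₂ ≟ᶠ u
    ... | yes refl | yes refl = refl
    ... | yes _    | no _     = ⊥-elim (edge⇒≢ vy₂ (cong proj₁ e))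
    ... | no _     | yes _    = ⊥-elim (edge⇒≢ vy₁ (sym (cong proj₁ e)))
    ... | no _     | no _     = cong proj₁ e

    spoke≢xu : ∀ {y} (vy : Edge G v y) → proj₁ (spoke y vy) ≢ (x , u)
    spoke≢xu {y} vy e with y ≟ᶠ u
    ... | yes _ = x≢v (sym (cong proj₁ e))
    ... | no _  = edge⇒≢ vu (cong proj₂ e)

    spoke-meets-uv : ∀ {y} (vy : Edge G v y) (uv-shuntable : T (shuntable G u v)) →
                     A1Adj G ((u , v) , uv-shuntable) (spoke y vy)
    spoke-meets-uv {y} vy _ with y ≟ᶠ u
    ... | yes _   = edge⇒≢ vu ∘ sym ∘ cong proj₁ , inj₁ (inj₂ refl)
    ... | no y≢u  = y≢u ∘ sym ∘ cong proj₁ , inj₂ (inj₂ refl)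

    arc : Fin (suc (degree v)) → A1Vertex G
    arc zero    = (x , u) , shuntable⁺ (edge-sym ux) (edge-sym vu) (x≢v ∘ sym)
    arc (suc i) = spoke (member (adj G v) i) (member-satisfies (adj G v) i)

    arc-injective : Injective _≡_ _≡_ (proj₁ ∘ arc)
    arc-injective {zero}  {zero}  _ = refl
    arc-injective {zero}  {suc j} e = ⊥-elim (spoke≢xu (member-satisfies (adj G v) j) (sym e))
    arc-injective {suc i} {zero}  e = ⊥-elim (spoke≢xu (member-satisfies (adj G v) i) e)
    arc-injective {suc i} {suc j} e = cong suc (member-injective (adj G v)
      (spoke-injective (member-satisfies (adj G v) i) (member-satisfies (adj G v) j) e))

    arc-meets-uv : (uv-shuntable : T (shuntable G u v)) → ∀ i → A1Adj G ((u , v) , uv-shuntable) (arc i)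
    arc-meets-uv _ zero    = edge⇒≢ vu ∘ cong proj₂ , inj₁ (inj₂ refl)
    arc-meets-uv s (suc i) = spoke-meets-uv (member-satisfies (adj G v) i) s

  module Unshuntable (v : Fin n) (stuck : ∀ u → ¬ T (shuntable G v u)) where

    reachable⇒closedNeighbour : ∀ {z} → Reach G v z → z ≡ v ⊎ Edge G v z
    reachable⇒closedNeighbour here                         = inj₁ refl
    reachable⇒closedNeighbour (step vy here)               = inj₂ vy
    reachable⇒closedNeighbour (step {v = y} vy (step {v = w} yw r)) with w ≟ᶠ v
    ... | yes refl = reachable⇒closedNeighbour r
    ... | no w≢v   = ⊥-elim (stuck y (shuntable⁺ vy yw w≢v))

    shuntable⇒head≡ : Connected G → ∀ {c d} → T (shuntable G c d) → d ≡ v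
    shuntable⇒head≡ connected {c} {d} s with shuntable⇒ s
    ... | cd , w , dw , w≢c with reachable⇒closedNeighbour (connected v d)
    ... | inj₁ d≡v = d≡v
    ... | inj₂ vd with c ≟ᶠ v
    ... | yes refl = ⊥-elim (stuck d (shuntable⁺ vd dw w≢c))
    ... | no c≢v   = ⊥-elim (stuck d (shuntable⁺ vd (edge-sym cd) c≢v))

module Isomorphism {n : ℕ} (G : Graph n) (f : Fin n → A1Vertex G)
                   (f-bijective : Bijective _≡_ _≡_ f)
                   (f-iso : ∀ x y → Edge G x y ⇔ A1Adj G (f x) (f y)) where

  f-injective : Injective _≡_ _≡_ f
  f-injective = proj₁ f-bijective

  f⁻¹ : A1Vertex G → Fin n
  f⁻¹ a = proj₁ (proj₂ f-bijective a)

  f∘f⁻¹ : ∀ a → f (f⁻¹ a) ≡ a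
  f∘f⁻¹ a = proj₂ (proj₂ f-bijective a) refl

  f⁻¹-injective : Injective _≡_ _≡_ f⁻¹
  f⁻¹-injective {a} {b} e = trans (sym (f∘f⁻¹ a)) (trans (cong f e) (f∘f⁻¹ b))

  A1Adj⇒Edge : ∀ {a b} → A1Adj G a b → Edge G (f⁻¹ a) (f⁻¹ b)
  A1Adj⇒Edge {a} {b} ab = Equivalence.from (f-iso (f⁻¹ a) (f⁻¹ b))
    (subst₂ (A1Adj G) (sym (f∘f⁻¹ a)) (sym (f∘f⁻¹ b)) ab)

  A1-neighbours⇒≤degree : ∀ {k} (a : A1Vertex G) (g : Fin k → A1Vertex G) →
                          Injective _≡_ _≡_ (proj₁ ∘ g) → (∀ i → A1Adj G a (g i)) →
                          k ≤ degree G (f⁻¹ a)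
  A1-neighbours⇒≤degree a g g-injective meets =
    injection⇒≤count (adj G (f⁻¹ a)) (f⁻¹ ∘ g) (A1Adj⇒Edge ∘ meets)
      (g-injective ∘ cong proj₁ ∘ f⁻¹-injective)

  maxDegree⇒unshuntable : ∀ {v} → (∀ y → degree G y ≤ degree G v) → ∀ u → ¬ T (shuntable G v u)
  maxDegree⇒unshuntable {v} v-max u vu-shuntable =
    1+n≰n (≤-trans (A1-neighbours⇒≤degree uv arc arc-injective (arc-meets-uv uv-shuntable)) (v-max _))
    where
      open ArcsAround G vu-shuntable
      other-neighbour : ∃ λ w → Edge G v w × w ≢ u
      other-neighbour = 2≤degree⇒other-neighbour G
        (≤-trans (two-neighbours⇒2≤degree G (edge-sym G vu) ux (x≢v ∘ sym)) (v-max u)) u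
      uv-shuntable : T (shuntable G u v)
      uv-shuntable =
        shuntable⁺ G (edge-sym G vu) (proj₁ (proj₂ other-neighbour)) (proj₂ (proj₂ other-neighbour))
      uv : A1Vertex G
      uv = (u , v) , uv-shuntable

  unshuntable⇒⊥ : Connected G → Fin n → ∀ v → (∀ u → ¬ T (shuntable G v u)) → ⊥
  unshuntable⇒⊥ connected x₀ v stuck with f x₀
  ... | (a , b) , s with Unshuntable.shuntable⇒head≡ G v stuck connected s | shuntable⇒ G s
  ... | refl | ab , w , bw , w≢a = stuck a (shuntable⁺ G (edge-sym G ab) aw (edge⇒≢ G bw ∘ sym))
    where
      open Unshuntable G v stuck
      aw : Edge G a w
      aw = Equivalence.from (f-iso a w)
        ( w≢a ∘ sym ∘ f-injective ∘ A1Vertex-≡ G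
        , inj₂ (inj₂ (trans (shuntable⇒head≡ connected (proj₂ (f a)))
                            (sym (shuntable⇒head≡ connected (proj₂ (f w)))))))

mainTheorem20 : (n : ℕ) → 1 ≤ n → (G : Graph n) → Connected G → ¬ IsoToA1 G
mainTheorem20 (suc _) _ G connected (f , f-bijective , f-iso) =
  unshuntable⇒⊥ connected zero v (maxDegree⇒unshuntable v-max)
  where
    open Isomorphism G f f-bijective f-iso
    v : Fin _
    v = proj₁ (maxDegreeVertex G zero)
    v-max : ∀ y → degree G y ≤ degree G v
    v-max = proj₂ (maxDegreeVertex G zero)
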